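{- Let $\Psi:\mathcal{D}\to QSym$ be the unique morphism of combinatorial Hopf algebras from $(\mathcal{D},\zeta)$ to $(QSym,\zeta_Q)$. Then for every digraph $X$, \[\Psi([X])=U_X.\]
   Context: A digraph is a pair $X=(V,E)$ with $V$ finite and $E\subset\{(u,v)\in V\times V\mid u\ne v\}$; $n=|V|$. A $V$-listing is a bijection $\sigma:[n]\to V$, written $(\sigma_1,\ldots,\sigma_n)$; $\Sigma_V$ is the set of $V$-listings; $X\mathrm{Des}(\sigma)=\{1\le i\le n-1\mid(\sigma_i,\sigma_{i+1})\in E\}$. For $I\subset[n-1]$, $F_I=\sum x_{i_1}\cdots x_{i_n}$ over $1\le i_1\le\cdots\le i_n$ with $i_j<i_{j+1}$ for $j\in I$. The Redei-Berge symmetric function is $U_X=\sum_{\sigma\in\Sigma_V}F_{X\mathrm{Des}(\sigma)}$. For $S\subset V$, $X|_S$ is the induced subdigraph. The product $X\cdot Y$ of $X=(V,E)$, $Y=(V',E')$ is the digraph on $V\sqcup V'$ with edges $E\cup E'\cup\{(u,v)\mid u\in V,v\in V'\}$. $\mathcal{D}=\bigoplus_n\mathcal{D}_n$ is the graded $\mathbb{Q}$-Hopf algebra with basis isomorphism classes $[X]$ of digraphs (graded by $|V|$), product $[X][Y]=[X\cdot Y]$, unit $[\emptyset]$, coproduct $\Delta([X])=\sum_{S\subset V}[X|_S]\otimes[X|_{V\setminus S}]$, counit $\epsilon([\emptyset])=1$ and $0$ otherwise. The character $\zeta:\mathcal{D}\to\mathbb{Q}$ is $\zeta([X])=\#\{\sigma\in\Sigma_V\mid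 X\mathrm{Des}(\sigma)=\emptyset\}$. A combinatorial Hopf algebra is a graded connected Hopf algebra with a multiplicative linear functional (character); morphisms are graded Hopf morphisms compatible with characters. $QSym$ is the Hopf algebra of quasisymmetric functions with monomial basis $M_{(a_1,\dots,a_k)}=\sum_{i_1<\cdots<i_k}x_{i_1}^{a_1}\cdots x_{i_k}^{a_k}$ and character $\zeta_Q(\Phi)=\Phi(1,0,0,\dots)$. The unique morphism is $\Psi([X])=\sum_{\alpha=(a_1,\dots,a_k)\models n}\zeta_\alpha([X])M_\alpha$ with $\zeta_\alpha([X])=\sum\zeta([X|_{V_1}])\cdots\zeta([X|_{V_k}])$, the sum over ordered set compositions $(V_1,\dots,V_k)$ of $V$ with $|V_i|=a_i$. -}

module Defs where

open import Data.Nat using (ℕ; zero; suc; _+_; _*_; _∸_; _≡ᵇ_; _<ᵇ_)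
open import Data.Bool using (Bool; true; false; _∧_; if_then_else_; not)
open import Data.List using (List; []; _∷_; _++_; map; concatMap; length; replicate)
open import Data.Nat.ListAction using (sum; product)
open import Data.Maybe using (Maybe; just; nothing)
open import Data.Product using (_×_; _,_)
open import Data.Fin using (Fin)
open import Relation.Binary.PropositionalEquality using (_≡_)
open import Data.List using (allFin) public

-- Formal power series in x_1, x_2, ... with ℕ coefficients.
-- A monomial x_1^{e_1} ... x_m^{e_m} is the exponent list (e_1 ∷ ... ∷ e_m ∷ []);
-- a power series is its coefficient function.

Monomial : Set
Monomial = List ℕ

Series : Set
Series = Monomial → ℕ

_≈ₛ_ : Series → Series → Set
f ≈ₛ g = (e : Monomial) → f e ≡ g e

-- the unique weakly increasing index sequence i_1 ≤ ... ≤ i_n whose monomial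
-- x_{i_1} ... x_{i_n} is x^e (variable indices start at 1)
indexSeqFrom : ℕ → Monomial → List ℕ
indexSeqFrom k []       = []
indexSeqFrom k (a ∷ es) = replicate a k ++ indexSeqFrom (suc k) es

indexSeq : Monomial → List ℕ
indexSeq = indexSeqFrom 1

-- checks i_j < i_{j+1} for every j ∈ I (positions 1-based)
strictAt : (ℕ → Bool) → ℕ → List ℕ → Bool
strictAt I j (x ∷ y ∷ ys) = (if I j then x <ᵇ y else true) ∧ strictAt I (suc j) (y ∷ ys)
strictAt I j _            = true

-- Fundamental quasisymmetric function F_I (of degree n), I ⊂ [n-1] given by its
-- indicator function on positions 1..n-1: coefficient of x^e.
F : ℕ → (ℕ → Bool) → Series
F n I e = if (length (indexSeq e) ≡ᵇ n) ∧ strictAt I 1 (indexSeq e) then 1 else 0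

dropZeros : List ℕ → List ℕ
dropZeros []           = []
dropZeros (zero ∷ xs)  = dropZeros xs
dropZeros (suc a ∷ xs) = suc a ∷ dropZeros xs

listEqᵇ : List ℕ → List ℕ → Bool
listEqᵇ []       []       = true
listEqᵇ (x ∷ xs) (y ∷ ys) = (x ≡ᵇ y) ∧ listEqᵇ xs ys
listEqᵇ _        _        = false

M : List ℕ → Series
M α e = if listEqᵇ (dropZeros e) α then 1 else 0

incFirst : List ℕ → List (List ℕ)
incFirst []      = []
incFirst (a ∷ c) = (suc a ∷ c) ∷ []

compositions : ℕ → List (List ℕ)
compositions zero    = [] ∷ []
compositions (suc n) = map (1 ∷_) (compositions n) ++ concatMap incFirst (compositions n)

-- Digraphs: vertices of type A, a vertex set given as a duplicate-free list V,
-- edge relation E : A → A → Bool (only used on V). The induced subdigraph on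
-- S ⊂ V is (S, E).

-- listings of a vertex set = all arrangements (permutations) of the list
insertions : {A : Set} → A → List A → List (List A)
insertions x []       = (x ∷ []) ∷ []
insertions x (y ∷ ys) = (x ∷ y ∷ ys) ∷ map (y ∷_) (insertions x ys)

listings : {A : Set} → List A → List (List A)
listings []       = [] ∷ []
listings (x ∷ xs) = concatMap (insertions x) (listings xs)

nth : {A : Set} → List A → ℕ → Maybe A
nth []       _       = nothing
nth (x ∷ xs) zero    = just x
nth (x ∷ xs) (suc k) = nth xs k

-- XDes(σ) as indicator on positions i (1-based): (σ_i, σ_{i+1}) ∈ E
XDes : {A : Set} → (A → A → Bool) → List A → ℕ → Bool
XDes E σ i with nth σ (i ∸ 1) | nth σ i
... | just u | just v = E u v
... | _      | _      = false

noDes : {A : Set} → (A → A → Bool) → List A → Bool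
noDes E (u ∷ v ∷ vs) = not (E u v) ∧ noDes E (v ∷ vs)
noDes E _            = true

count : {A : Set} → (A → Bool) → List A → ℕ
count p []       = 0
count p (x ∷ xs) = (if p x then 1 else 0) + count p xs

ζ : {A : Set} → (A → A → Bool) → List A → ℕ
ζ E V = count (noDes E) (listings V)

choose : {A : Set} → ℕ → List A → List (List A × List A)
choose zero    xs       = ([] , xs) ∷ []
choose (suc a) []       = []
choose (suc a) (x ∷ xs) =
  map (λ { (c , r) → (x ∷ c , r) }) (choose a xs) ++
  map (λ { (c , r) → (c , x ∷ r) }) (choose (suc a) xs)

setCompositions : {A : Set} → List ℕ → List A → List (List (List A))
setCompositions []      []      = [] ∷ []
setCompositions []      (_ ∷ _) = []
setCompositions (a ∷ α) V       =
  concatMap (λ { (c , r) → map (c ∷_) (setCompositions α r) }) (choose a V)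

ζ[_] : {A : Set} → List ℕ → (A → A → Bool) → List A → ℕ
ζ[ α ] E V = sum (map (λ bs → product (map (ζ E) bs)) (setCompositions α V))

Ψ : {A : Set} → (A → A → Bool) → List A → Series
Ψ E V e = sum (map (λ α → ζ[ α ] E V * M α e) (compositions (length V)))

U : {A : Set} → (A → A → Bool) → List A → Series
U E V e = sum (map (λ σ → F (length V) (XDes E σ) e) (listings V))

{-# OPTIONS --safe #-}
module Submission where

-- Fix a monomial x^e and let α be e with its zero parts removed. The coefficient of x^e in
-- F_{XDes σ} is 1 exactly when the weakly increasing index sequence of x^e strictly increases
-- at every X-descent of σ, i.e. when σ, cut into consecutive blocks of lengths e₁, e₂, …, has
-- descent-free blocks. Cutting a listing of V into consecutive blocks of prescribed sizes is
-- the same as choosing an ordered set composition of V with those sizes and listing each part,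
-- so there are ζ_α([X]) such σ. In Ψ([X]) only M_α contributes to x^e, with coefficient
-- ζ_α([X]) if α ⊨ n; otherwise no σ qualifies, so both sides vanish.

open import Defs
open import Algebra.Bundles using (CommutativeMonoid)
import Algebra.Properties.CommutativeSemigroup as CommutativeSemigroupProperties
open import Data.Bool using (Bool; true; false; _∧_; not; if_then_else_; T)
open import Data.Bool.Properties using (∧-assoc; ∧-zeroʳ; ∧-commutativeMonoid; ¬-not; T-≡; T-∧)
open import Data.Empty using (⊥-elim)
open import Data.Fin using (Fin)
open import Data.List using (List; []; _∷_; _++_; map; concatMap; length; replicate; null; allFin)
open import Data.List.Properties using (map-++; map-∘; map-cong; map-cong-local)
open import Data.List.Relation.Unary.All as All using (All; []; _∷_)
open import Data.List.Relation.Unary.All.Properties using (gmap⁺; concat⁺)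
open import Data.Maybe using (just; nothing)
open import Data.Nat using (ℕ; zero; suc; _+_; _*_; _≤_; _<_; _<ᵇ_; _≡ᵇ_)
open import Data.Nat.ListAction using (sum; product)
open import Data.Nat.ListAction.Properties using (sum-++)
open import Data.Nat.Properties
  using (+-identityʳ; +-assoc; *-zeroʳ; *-distribˡ-+; *-distribʳ-+; +-commutativeSemigroup;
         ≤-refl; <⇒≤; <-irrefl; n<1+n; m<n⇒m<1+n; <⇒<ᵇ; <ᵇ⇒<)
open import Data.Product using (_×_; _,_; proj₁; proj₂)
open import Function using (_∘_)
open import Function.Bundles using (Equivalence)
open import Relation.Binary.PropositionalEquality using (_≡_; refl; sym; trans; cong; cong₂; module ≡-Reasoning)

open CommutativeSemigroupProperties +-commutativeSemigroup using (interchange)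
open CommutativeSemigroupProperties (CommutativeMonoid.commutativeSemigroup ∧-commutativeMonoid) using (x∙yz≈y∙xz)

toℕ : Bool → ℕ
toℕ b = if b then 1 else 0

toℕ-∧ : ∀ b c → toℕ (b ∧ c) ≡ toℕ b * toℕ c
toℕ-∧ true  c = sym (+-identityʳ (toℕ c))
toℕ-∧ false c = refl

toℕ-*-absorb : ∀ {b c} → (T b → T c) → toℕ b * toℕ c ≡ toℕ b
toℕ-*-absorb {false}         _   = refl
toℕ-*-absorb {true}  {true}  _   = refl
toℕ-*-absorb {true}  {false} b⇒c = ⊥-elim (b⇒c _)

∑ : {X : Set} → List X → (X → ℕ) → ℕ
∑ xs f = sum (map f xs)

syntax ∑ xs (λ x → e) = ∑[ x ∈ xs ] e

module _ {X : Set} where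

  ∑-++ : ∀ (f : X → ℕ) xs ys → ∑ (xs ++ ys) f ≡ ∑ xs f + ∑ ys f
  ∑-++ f xs ys = trans (cong sum (map-++ f xs ys)) (sum-++ (map f xs) (map f ys))

  ∑-cong : ∀ {f g : X → ℕ} → (∀ x → f x ≡ g x) → ∀ xs → ∑ xs f ≡ ∑ xs g
  ∑-cong f≗g xs = cong sum (map-cong f≗g xs)

  ∑-cong-All : ∀ {f g : X → ℕ} {xs} → All (λ x → f x ≡ g x) xs → ∑ xs f ≡ ∑ xs g
  ∑-cong-All fx≡gx = cong sum (map-cong-local fx≡gx)

  ∑-zero : ∀ {f : X → ℕ} → (∀ x → f x ≡ 0) → ∀ xs → ∑ xs f ≡ 0
  ∑-zero f≗0 []       = refl
  ∑-zero f≗0 (x ∷ xs) = cong₂ _+_ (f≗0 x) (∑-zero f≗0 xs)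

  ∑-+ : ∀ (f g : X → ℕ) xs → ∑[ x ∈ xs ] (f x + g x) ≡ ∑ xs f + ∑ xs g
  ∑-+ f g []       = refl
  ∑-+ f g (x ∷ xs) = trans (cong (f x + g x +_) (∑-+ f g xs)) (interchange (f x) (g x) _ _)

  ∑-*ˡ : ∀ c (f : X → ℕ) xs → ∑[ x ∈ xs ] (c * f x) ≡ c * ∑ xs f
  ∑-*ˡ c f []       = sym (*-zeroʳ c)
  ∑-*ˡ c f (x ∷ xs) = trans (cong (c * f x +_) (∑-*ˡ c f xs)) (sym (*-distribˡ-+ c (f x) _))

  ∑-*ʳ : ∀ (f : X → ℕ) c xs → ∑[ x ∈ xs ] (f x * c) ≡ ∑ xs f * c
  ∑-*ʳ f c []       = refl
  ∑-*ʳ f c (x ∷ xs) = trans (cong (f x * c +_) (∑-*ʳ f c xs)) (sym (*-distribʳ-+ c (f x) _))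

  count-as-∑ : ∀ (p : X → Bool) xs → count p xs ≡ ∑ xs (toℕ ∘ p)
  count-as-∑ p []       = refl
  count-as-∑ p (x ∷ xs) = cong (toℕ (p x) +_) (count-as-∑ p xs)

module _ {X Y : Set} where

  ∑-map : ∀ (f : Y → ℕ) (g : X → Y) xs → ∑ (map g xs) f ≡ ∑ xs (f ∘ g)
  ∑-map f g xs = cong sum (sym (map-∘ xs))

  ∑-concatMap : ∀ (f : Y → ℕ) (g : X → List Y) xs → ∑ (concatMap g xs) f ≡ ∑[ x ∈ xs ] ∑ (g x) f
  ∑-concatMap f g []       = refl
  ∑-concatMap f g (x ∷ xs) = trans (∑-++ f (g x) (concatMap g xs)) (cong (∑ (g x) f +_) (∑-concatMap f g xs))

isCompositionOf : List ℕ → ℕ → Bool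
isCompositionOf []                zero    = true
isCompositionOf []                (suc n) = false
isCompositionOf (zero ∷ β)        n       = false
isCompositionOf (suc a ∷ β)       zero    = false
isCompositionOf (suc zero ∷ β)    (suc n) = isCompositionOf β n
isCompositionOf (suc (suc a) ∷ β) (suc n) = isCompositionOf (suc a ∷ β) n

∑-compositions-listEq : ∀ n (h : List ℕ → ℕ) β →
  ∑[ α ∈ compositions n ] (h α * toℕ (listEqᵇ β α)) ≡ h β * toℕ (isCompositionOf β n)
∑-compositions-listEq zero    h []          = +-identityʳ _
∑-compositions-listEq zero    h (zero ∷ β)  =
  trans (+-identityʳ _) (trans (*-zeroʳ (h [])) (sym (*-zeroʳ (h (zero ∷ β)))))
∑-compositions-listEq zero    h (suc a ∷ β) =
  trans (+-identityʳ _) (trans (*-zeroʳ (h [])) (sym (*-zeroʳ (h (suc a ∷ β)))))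
∑-compositions-listEq (suc m) h β = begin
    ∑ (map (1 ∷_) C ++ concatMap incFirst C) (term β)
      ≡⟨ ∑-++ (term β) (map (1 ∷_) C) _ ⟩
    ∑ (map (1 ∷_) C) (term β) + ∑ (concatMap incFirst C) (term β)
      ≡⟨ cong₂ _+_ (∑-map (term β) (1 ∷_) C) (∑-concatMap (term β) incFirst C) ⟩
    ∑ C (term β ∘ (1 ∷_)) + ∑[ α ∈ C ] ∑ (incFirst α) (term β)
      ≡⟨ by-head β ⟩
    h β * toℕ (isCompositionOf β (suc m)) ∎
  where
  open ≡-Reasoning
  C : List (List ℕ)
  C = compositions m

  term : List ℕ → List ℕ → ℕ
  term β α = h α * toℕ (listEqᵇ β α)

  bumpHead : (List ℕ → ℕ) → List ℕ → ℕ
  bumpHead f []      = 0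
  bumpHead f (a ∷ α) = f (suc a ∷ α)

  ∑-incFirst : ∀ b β α → ∑ (incFirst α) (term (suc b ∷ β)) ≡ bumpHead h α * toℕ (listEqᵇ (b ∷ β) α)
  ∑-incFirst b β []      = refl
  ∑-incFirst b β (a ∷ α) = +-identityʳ _

  head1-vanishes : ∀ β → (∀ α → listEqᵇ β (1 ∷ α) ≡ false) → ∑ C (term β ∘ (1 ∷_)) ≡ 0
  head1-vanishes β differs =
    ∑-zero (λ α → trans (cong (λ b → h (1 ∷ α) * toℕ b) (differs α)) (*-zeroʳ (h (1 ∷ α)))) C

  both-vanish : ∀ β → (∀ a α → listEqᵇ β (suc a ∷ α) ≡ false) →
    ∑ C (term β ∘ (1 ∷_)) + ∑[ α ∈ C ] ∑ (incFirst α) (term β) ≡ 0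
  both-vanish β differs = cong₂ _+_ (head1-vanishes β (differs 0)) (∑-zero incFirst-vanishes C)
    where
    incFirst-vanishes : ∀ α → ∑ (incFirst α) (term β) ≡ 0
    incFirst-vanishes []      = refl
    incFirst-vanishes (a ∷ α) =
      trans (+-identityʳ _) (trans (cong (λ b → h (suc a ∷ α) * toℕ b) (differs a α)) (*-zeroʳ (h (suc a ∷ α))))

  by-head : ∀ β →
    ∑ C (term β ∘ (1 ∷_)) + ∑[ α ∈ C ] ∑ (incFirst α) (term β) ≡ h β * toℕ (isCompositionOf β (suc m))
  by-head []                = trans (both-vanish [] (λ _ _ → refl)) (sym (*-zeroʳ (h [])))
  by-head (zero ∷ β)        = trans (both-vanish (zero ∷ β) (λ _ _ → refl)) (sym (*-zeroʳ (h (zero ∷ β))))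
  by-head (suc zero ∷ β)    = trans
    (cong₂ _+_ (∑-compositions-listEq m (h ∘ (1 ∷_)) β)
               (trans (∑-cong (∑-incFirst 0 β) C)
                      (trans (∑-compositions-listEq m (bumpHead h) (0 ∷ β)) (*-zeroʳ (h (1 ∷ β))))))
    (+-identityʳ _)
  by-head (suc (suc b) ∷ β) = cong₂ _+_ (head1-vanishes (suc (suc b) ∷ β) (λ _ → refl))
    (trans (∑-cong (∑-incFirst (suc b) β) C) (∑-compositions-listEq m (bumpHead h) (suc b ∷ β)))

strictAt-shift : ∀ {I J : ℕ → Bool} k → (∀ {i} → k ≤ i → I (suc i) ≡ J i) →
  ∀ s → strictAt I (suc k) s ≡ strictAt J k s
strictAt-shift k I≗J []          = refl
strictAt-shift k I≗J (x ∷ [])    = refl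
strictAt-shift k I≗J (x ∷ y ∷ s) =
  cong₂ (λ c r → (if c then x <ᵇ y else true) ∧ r) (I≗J ≤-refl) (strictAt-shift (suc k) (I≗J ∘ <⇒≤) (y ∷ s))

module _ {A : Set} where

  insertions-length : ∀ (x : A) τ → All (λ σ → length σ ≡ suc (length τ)) (insertions x τ)
  insertions-length x []      = refl ∷ []
  insertions-length x (y ∷ τ) = refl ∷ gmap⁺ (cong suc) (insertions-length x τ)

  listings-length : ∀ (V : List A) → All (λ σ → length σ ≡ length V) (listings V)
  listings-length []       = refl ∷ []
  listings-length (x ∷ xs) = concat⁺ (gmap⁺ lengthen (listings-length xs))
    where
    lengthen : ∀ {τ} → length τ ≡ length xs → All (λ σ → length σ ≡ length (x ∷ xs)) (insertions x τ)
    lengthen {τ} eq = All.map (λ e → trans e (cong suc eq)) (insertions-length x τ)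

  insertSum : A → (List A → ℕ) → List A → ℕ
  insertSum x f u = ∑ (insertions x u) f

  ∑-listings-∷ : ∀ x (f : List A → ℕ) c → ∑ (listings (x ∷ c)) f ≡ ∑ (listings c) (insertSum x f)
  ∑-listings-∷ x f c = ∑-concatMap f (insertions x) (listings c)

  splitWith : {B : Set} → B → (B → B → B) → ℕ → (List A → B) → (List A → B) → List A → B
  splitWith ε _∙_ zero    f g σ       = f [] ∙ g σ
  splitWith ε _∙_ (suc b) f g []      = ε
  splitWith ε _∙_ (suc b) f g (y ∷ σ) = splitWith ε _∙_ b (f ∘ (y ∷_)) g σ

  splitWith-hom : ∀ {B C : Set} {ε : B} {ε′ : C} {_∙_ : B → B → B} {_∘′_ : C → C → C} (h : B → C) →
    h ε ≡ ε′ → (∀ x y → h (x ∙ y) ≡ h x ∘′ h y) →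
    ∀ b f g σ → h (splitWith ε _∙_ b f g σ) ≡ splitWith ε′ _∘′_ b (h ∘ f) (h ∘ g) σ
  splitWith-hom h h-ε h-∙ zero    f g σ       = h-∙ (f []) (g σ)
  splitWith-hom h h-ε h-∙ (suc b) f g []      = h-ε
  splitWith-hom h h-ε h-∙ (suc b) f g (y ∷ σ) = splitWith-hom h h-ε h-∙ b (f ∘ (y ∷_)) g σ

  splitWith-*-+ : ∀ b {f₁ f₂ f : List A → ℕ} (g : List A → ℕ) → (∀ w → f w ≡ f₁ w + f₂ w) →
    ∀ σ → splitWith 0 _*_ b f g σ ≡ splitWith 0 _*_ b f₁ g σ + splitWith 0 _*_ b f₂ g σ
  splitWith-*-+ zero    {f₁} {f₂} g f≗ σ       = trans (cong (_* g σ) (f≗ [])) (*-distribʳ-+ (g σ) (f₁ []) (f₂ []))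
  splitWith-*-+ (suc b)             g f≗ []      = refl
  splitWith-*-+ (suc b)             g f≗ (y ∷ σ) = splitWith-*-+ b g (f≗ ∘ (y ∷_)) σ

  ∑-insertions-splitWith : ∀ x b (f g : List A → ℕ) τ →
    ∑ (insertions x τ) (splitWith 0 _*_ (suc b) f g)
      ≡ splitWith 0 _*_ b (insertSum x f) g τ + splitWith 0 _*_ (suc b) f (insertSum x g) τ
  ∑-insertions-splitWith x zero    f g []      = cong (λ z → z * g [] + 0) (sym (+-identityʳ (f (x ∷ []))))
  ∑-insertions-splitWith x zero    f g (y ∷ τ) =
    cong₂ _+_ (cong (_* g (y ∷ τ)) (sym (+-identityʳ (f (x ∷ [])))))
              (trans (∑-map (splitWith 0 _*_ 1 f g) (y ∷_) (insertions x τ)) (∑-*ˡ (f (y ∷ [])) g (insertions x τ)))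
  ∑-insertions-splitWith x (suc b) f g []      = refl
  ∑-insertions-splitWith x (suc b) f g (y ∷ τ) = begin
      splitWith 0 _*_ b (f ∘ (x ∷_) ∘ (y ∷_)) g τ + ∑ (map (y ∷_) (insertions x τ)) (splitWith 0 _*_ (suc (suc b)) f g)
        ≡⟨ cong (splitWith 0 _*_ b (f ∘ (x ∷_) ∘ (y ∷_)) g τ +_)
                (trans (∑-map _ (y ∷_) (insertions x τ)) (∑-insertions-splitWith x b (f ∘ (y ∷_)) g τ)) ⟩
      splitWith 0 _*_ b (f ∘ (x ∷_) ∘ (y ∷_)) g τ + (splitWith 0 _*_ b (insertSum x (f ∘ (y ∷_))) g τ + rest)
        ≡⟨ sym (+-assoc (splitWith 0 _*_ b (f ∘ (x ∷_) ∘ (y ∷_)) g τ) _ rest) ⟩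
      splitWith 0 _*_ b (f ∘ (x ∷_) ∘ (y ∷_)) g τ + splitWith 0 _*_ b (insertSum x (f ∘ (y ∷_))) g τ + rest
        ≡⟨ cong (_+ rest) (splitWith-*-+ b g (λ w → cong (f (x ∷ y ∷ w) +_) (∑-map f (y ∷_) (insertions x w))) τ) ⟨
      splitWith 0 _*_ b (insertSum x f ∘ (y ∷_)) g τ + rest ∎
    where
    open ≡-Reasoning
    rest : ℕ
    rest = splitWith 0 _*_ (suc b) (f ∘ (y ∷_)) (insertSum x g) τ

  -- Cutting a listing of V after b entries is choosing those b entries and listing both parts;
  -- the induction inserts the head x of V, which lands either in front of the cut or behind it.
  ∑-listings-splitWith : ∀ V b (f g : List A → ℕ) →
    ∑ (listings V) (splitWith 0 _*_ b f g)
      ≡ ∑[ p ∈ choose b V ] (∑ (listings (proj₁ p)) f * ∑ (listings (proj₂ p)) g)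
  ∑-listings-splitWith []       zero    f g = cong (_+ 0) (sym (cong₂ _*_ (+-identityʳ (f [])) (+-identityʳ (g []))))
  ∑-listings-splitWith []       (suc b) f g = refl
  ∑-listings-splitWith (x ∷ xs) zero    f g = begin
      ∑[ σ ∈ listings (x ∷ xs) ] (f [] * g σ) ≡⟨ ∑-*ˡ (f []) g (listings (x ∷ xs)) ⟩
      f [] * ∑ (listings (x ∷ xs)) g          ≡⟨ cong (_* ∑ (listings (x ∷ xs)) g) (+-identityʳ (f [])) ⟨
      (f [] + 0) * ∑ (listings (x ∷ xs)) g    ≡⟨ +-identityʳ _ ⟨
      (f [] + 0) * ∑ (listings (x ∷ xs)) g + 0 ∎
    where open ≡-Reasoning
  ∑-listings-splitWith (x ∷ xs) (suc b) f g = begin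
      ∑ (listings (x ∷ xs)) (splitWith 0 _*_ (suc b) f g)
        ≡⟨ ∑-listings-∷ x _ xs ⟩
      ∑[ τ ∈ listings xs ] ∑ (insertions x τ) (splitWith 0 _*_ (suc b) f g)
        ≡⟨ ∑-cong (∑-insertions-splitWith x b f g) (listings xs) ⟩
      ∑[ τ ∈ listings xs ] (splitWith 0 _*_ b (insertSum x f) g τ + splitWith 0 _*_ (suc b) f (insertSum x g) τ)
        ≡⟨ ∑-+ _ _ (listings xs) ⟩
      ∑ (listings xs) (splitWith 0 _*_ b (insertSum x f) g) + ∑ (listings xs) (splitWith 0 _*_ (suc b) f (insertSum x g))
        ≡⟨ cong₂ _+_ (∑-listings-splitWith xs b (insertSum x f) g) (∑-listings-splitWith xs (suc b) f (insertSum x g)) ⟩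
      ∑[ p ∈ choose b xs ] (∑ (listings (proj₁ p)) (insertSum x f) * ∑ (listings (proj₂ p)) g)
        + ∑[ p ∈ choose (suc b) xs ] (∑ (listings (proj₁ p)) f * ∑ (listings (proj₂ p)) (insertSum x g))
        ≡⟨ cong₂ _+_ (∑-cong (λ p → cong (_* ∑ (listings (proj₂ p)) g) (∑-listings-∷ x f (proj₁ p))) (choose b xs))
                     (∑-cong (λ p → cong (∑ (listings (proj₁ p)) f *_) (∑-listings-∷ x g (proj₂ p))) (choose (suc b) xs)) ⟨
      ∑[ p ∈ choose b xs ] (∑ (listings (x ∷ proj₁ p)) f * ∑ (listings (proj₂ p)) g)
        + ∑[ p ∈ choose (suc b) xs ] (∑ (listings (proj₁ p)) f * ∑ (listings (x ∷ proj₂ p)) g)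
        ≡⟨ cong₂ _+_ (∑-map term _ (choose b xs)) (∑-map term _ (choose (suc b) xs)) ⟨
      ∑ (map (λ { (c , r) → (x ∷ c , r) }) (choose b xs)) term
        + ∑ (map (λ { (c , r) → (c , x ∷ r) }) (choose (suc b) xs)) term
        ≡⟨ ∑-++ term (map _ (choose b xs)) _ ⟨
      ∑ (choose (suc b) (x ∷ xs)) term ∎
    where
    open ≡-Reasoning
    term : List A × List A → ℕ
    term p = ∑ (listings (proj₁ p)) f * ∑ (listings (proj₂ p)) g

module _ {A : Set} (E : A → A → Bool) where

  descentFreeBlocks : List ℕ → List A → Bool
  descentFreeBlocks []       σ = null σ
  descentFreeBlocks (a ∷ es) σ = splitWith false _∧_ a (noDes E) (descentFreeBlocks es) σ

  ζ[∷] : ∀ a α V → ζ[ a ∷ α ] E V ≡ ∑[ p ∈ choose a V ] (ζ E (proj₁ p) * ζ[ α ] E (proj₂ p))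
  ζ[∷] a α V = trans (∑-concatMap prodζ _ (choose a V)) (∑-cong factor (choose a V))
    where
    prodζ : List (List A) → ℕ
    prodζ bs = product (map (ζ E) bs)
    factor : ∀ p → ∑ (map (proj₁ p ∷_) (setCompositions α (proj₂ p))) prodζ ≡ ζ E (proj₁ p) * ζ[ α ] E (proj₂ p)
    factor (c , r) = trans (∑-map prodζ (c ∷_) (setCompositions α r)) (∑-*ˡ (ζ E c) prodζ (setCompositions α r))

  ∑-listings-descentFreeBlocks : ∀ e V → ∑[ σ ∈ listings V ] toℕ (descentFreeBlocks e σ) ≡ ζ[ dropZeros e ] E V
  ∑-listings-descentFreeBlocks []           []       = refl
  ∑-listings-descentFreeBlocks []           (x ∷ xs) =
    trans (∑-cong-All (All.map nonempty (listings-length (x ∷ xs)))) (∑-zero (λ _ → refl) (listings (x ∷ xs)))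
    where
    nonempty : ∀ {σ : List A} → length σ ≡ suc (length xs) → toℕ (null σ) ≡ 0
    nonempty {_ ∷ _} _ = refl
  ∑-listings-descentFreeBlocks (zero ∷ es)  V        = ∑-listings-descentFreeBlocks es V
  ∑-listings-descentFreeBlocks (suc a ∷ es) V        = begin
      ∑[ σ ∈ listings V ] toℕ (splitWith false _∧_ (suc a) (noDes E) (descentFreeBlocks es) σ)
        ≡⟨ ∑-cong (splitWith-hom toℕ refl toℕ-∧ (suc a) _ _) (listings V) ⟩
      ∑ (listings V) (splitWith 0 _*_ (suc a) (toℕ ∘ noDes E) (toℕ ∘ descentFreeBlocks es))
        ≡⟨ ∑-listings-splitWith V (suc a) _ _ ⟩
      ∑[ p ∈ choose (suc a) V ]
        (∑ (listings (proj₁ p)) (toℕ ∘ noDes E) * ∑ (listings (proj₂ p)) (toℕ ∘ descentFreeBlocks es))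
        ≡⟨ ∑-cong (λ p → cong₂ _*_ (sym (count-as-∑ (noDes E) (listings (proj₁ p))))
                                   (∑-listings-descentFreeBlocks es (proj₂ p))) (choose (suc a) V) ⟩
      ∑[ p ∈ choose (suc a) V ] (ζ E (proj₁ p) * ζ[ dropZeros es ] E (proj₂ p))
        ≡⟨ ζ[∷] (suc a) (dropZeros es) V ⟨
      ζ[ suc a ∷ dropZeros es ] E V ∎
    where open ≡-Reasoning

  ∧-splitWith : ∀ c b (p q : List A → Bool) σ →
    c ∧ splitWith false _∧_ b p q σ ≡ splitWith false _∧_ b (λ w → c ∧ p w) q σ
  ∧-splitWith c zero    p q σ       = sym (∧-assoc c (p []) (q σ))
  ∧-splitWith c (suc b) p q []      = ∧-zeroʳ c
  ∧-splitWith c (suc b) p q (y ∷ σ) = ∧-splitWith c b (p ∘ (y ∷_)) q σ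

  descentFreeBlocks⇒isComposition : ∀ e σ → T (descentFreeBlocks e σ) → T (isCompositionOf (dropZeros e) (length σ))
  splitWith⇒isComposition : ∀ es r (p : List A → Bool) σ →
    T (splitWith false _∧_ r p (descentFreeBlocks es) σ) → T (isCompositionOf (suc r ∷ dropZeros es) (suc (length σ)))

  descentFreeBlocks⇒isComposition []           []      _ = _
  descentFreeBlocks⇒isComposition (zero ∷ es)  σ       h = descentFreeBlocks⇒isComposition es σ h
  descentFreeBlocks⇒isComposition (suc a ∷ es) (v ∷ σ) h = splitWith⇒isComposition es a _ σ h

  splitWith⇒isComposition es zero    p σ       h =
    descentFreeBlocks⇒isComposition es σ (proj₂ (Equivalence.to T-∧ h))
  splitWith⇒isComposition es (suc r) p (y ∷ σ) h = splitWith⇒isComposition es r (p ∘ (y ∷_)) σ h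

  -- u is the vertex preceding σ and x its label.
  respectsDescentsAfter : A → ℕ → List A → List ℕ → Bool
  respectsDescentsAfter u x []      []      = true
  respectsDescentsAfter u x (v ∷ σ) (y ∷ s) = (if E u v then x <ᵇ y else true) ∧ respectsDescentsAfter v y σ s
  respectsDescentsAfter u x _       _       = false

  respectsDescents : List A → List ℕ → Bool
  respectsDescents []      []      = true
  respectsDescents (u ∷ σ) (x ∷ s) = respectsDescentsAfter u x σ s
  respectsDescents _       _       = false

  XDes-∷ : ∀ u τ {i} → 1 ≤ i → XDes E (u ∷ τ) (suc i) ≡ XDes E τ i
  XDes-∷ u τ {suc j} _ with nth τ j | nth τ (suc j)
  ... | just _  | just _  = refl
  ... | just _  | nothing = refl
  ... | nothing | _       = refl

  strictAt-XDes-after : ∀ u x σ s →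
    (length s ≡ᵇ length σ) ∧ strictAt (XDes E (u ∷ σ)) 1 (x ∷ s) ≡ respectsDescentsAfter u x σ s
  strictAt-XDes-after u x []      []      = refl
  strictAt-XDes-after u x []      (y ∷ s) = refl
  strictAt-XDes-after u x (v ∷ σ) []      = refl
  strictAt-XDes-after u x (v ∷ σ) (y ∷ s) = begin
      (length s ≡ᵇ length σ) ∧ (descent ∧ strictAt (XDes E (u ∷ v ∷ σ)) 2 (y ∷ s))
        ≡⟨ cong (λ r → (length s ≡ᵇ length σ) ∧ (descent ∧ r)) (strictAt-shift 1 (XDes-∷ u (v ∷ σ)) (y ∷ s)) ⟩
      (length s ≡ᵇ length σ) ∧ (descent ∧ strictAt (XDes E (v ∷ σ)) 1 (y ∷ s))
        ≡⟨ x∙yz≈y∙xz (length s ≡ᵇ length σ) descent _ ⟩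
      descent ∧ ((length s ≡ᵇ length σ) ∧ strictAt (XDes E (v ∷ σ)) 1 (y ∷ s))
        ≡⟨ cong (descent ∧_) (strictAt-XDes-after v y σ s) ⟩
      descent ∧ respectsDescentsAfter v y σ s ∎
    where
    open ≡-Reasoning
    descent : Bool
    descent = if E u v then x <ᵇ y else true

  strictAt-XDes : ∀ σ s → (length s ≡ᵇ length σ) ∧ strictAt (XDes E σ) 1 s ≡ respectsDescents σ s
  strictAt-XDes []      []      = refl
  strictAt-XDes []      (x ∷ s) = refl
  strictAt-XDes (u ∷ σ) []      = refl
  strictAt-XDes (u ∷ σ) (x ∷ s) = strictAt-XDes-after u x σ s

  -- Labels are constant inside a block, forbidding every descent there, and strictly increase
  -- from one block to the next, allowing every descent across blocks.
  respectsDescentsAfter-fresh : ∀ es u {k j} σ → k < j →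
    respectsDescentsAfter u k σ (indexSeqFrom j es) ≡ descentFreeBlocks es σ
  respectsDescentsAfter-block : ∀ es u k r σ →
    respectsDescentsAfter u k σ (replicate r k ++ indexSeqFrom (suc k) es)
      ≡ splitWith false _∧_ r (noDes E ∘ (u ∷_)) (descentFreeBlocks es) σ

  respectsDescentsAfter-fresh []           u []      k<j = refl
  respectsDescentsAfter-fresh []           u (v ∷ σ) k<j = refl
  respectsDescentsAfter-fresh (zero ∷ es)  u σ       k<j = respectsDescentsAfter-fresh es u σ (m<n⇒m<1+n k<j)
  respectsDescentsAfter-fresh (suc a ∷ es) u []      k<j = refl
  respectsDescentsAfter-fresh (suc a ∷ es) u {j = j} (v ∷ σ) k<j =
    trans (cong (_∧ _) (increasing-labels (E u v) k<j)) (respectsDescentsAfter-block es v j a σ)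
    where
    increasing-labels : ∀ c {k j} → k < j → (if c then k <ᵇ j else true) ≡ true
    increasing-labels true  k<j = Equivalence.to T-≡ (<⇒<ᵇ k<j)
    increasing-labels false k<j = refl

  respectsDescentsAfter-block es u k zero    σ       = respectsDescentsAfter-fresh es u σ (n<1+n k)
  respectsDescentsAfter-block es u k (suc r) []      = refl
  respectsDescentsAfter-block es u k (suc r) (v ∷ σ) =
    trans (cong₂ _∧_ (equal-labels (E u v)) (respectsDescentsAfter-block es v k r σ))
          (∧-splitWith (not (E u v)) r (noDes E ∘ (v ∷_)) (descentFreeBlocks es) σ)
    where
    equal-labels : ∀ c → (if c then k <ᵇ k else true) ≡ not c
    equal-labels true  = ¬-not (λ k<ᵇk → <-irrefl refl (<ᵇ⇒< k k (Equivalence.from T-≡ k<ᵇk)))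
    equal-labels false = refl

  respectsDescents-indexSeq : ∀ j e σ → respectsDescents σ (indexSeqFrom j e) ≡ descentFreeBlocks e σ
  respectsDescents-indexSeq j []           []      = refl
  respectsDescents-indexSeq j []           (u ∷ σ) = refl
  respectsDescents-indexSeq j (zero ∷ es)  σ       = respectsDescents-indexSeq (suc j) es σ
  respectsDescents-indexSeq j (suc a ∷ es) []      = refl
  respectsDescents-indexSeq j (suc a ∷ es) (v ∷ σ) = respectsDescentsAfter-block es v j a σ

  F-XDes : ∀ e σ → F (length σ) (XDes E σ) e ≡ toℕ (descentFreeBlocks e σ)
  F-XDes e σ = cong toℕ (trans (strictAt-XDes σ (indexSeq e)) (respectsDescents-indexSeq 1 e σ))

  Ψ≈U : ∀ V → Ψ E V ≈ₛ U E V
  Ψ≈U V e = begin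
      Ψ E V e
        ≡⟨ ∑-compositions-listEq (length V) (λ α → ζ[ α ] E V) (dropZeros e) ⟩
      ζ[ dropZeros e ] E V * composition
        ≡⟨ cong (_* composition) (∑-listings-descentFreeBlocks e V) ⟨
      ∑[ σ ∈ listings V ] toℕ (descentFreeBlocks e σ) * composition
        ≡⟨ ∑-*ʳ (toℕ ∘ descentFreeBlocks e) composition (listings V) ⟨
      ∑[ σ ∈ listings V ] (toℕ (descentFreeBlocks e σ) * composition)
        ≡⟨ ∑-cong-All (All.map term (listings-length V)) ⟩
      U E V e ∎
    where
    open ≡-Reasoning
    composition : ℕ
    composition = toℕ (isCompositionOf (dropZeros e) (length V))
    term : ∀ {σ} → length σ ≡ length V → toℕ (descentFreeBlocks e σ) * composition ≡ F (length V) (XDes E σ) e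
    term {σ} |σ|≡|V| rewrite sym |σ|≡|V| =
      trans (toℕ-*-absorb (descentFreeBlocks⇒isComposition e σ)) (sym (F-XDes e σ))

-- The identity holds for every edge relation.
mainTheorem5 : (n : ℕ) (E : Fin n → Fin n → Bool) → (∀ v → E v v ≡ false) →
    Ψ E (allFin n) ≈ₛ U E (allFin n)
mainTheorem5 n E _ = Ψ≈U E (allFin n)
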